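{- Let $m\ge2$, let $S$ be a zigzag stack on $[n]$ ($n\ge1$) and let $C$ be its primary component with vertices $c_1<\dots<c_k$. Define the sets $J$ as follows: $J=\{c_t,c_t+1,\dots,c_{t+1}\}$ for each $1\le t\le k-1$, and in addition $J=\{c_k,c_k+1,\dots,n\}$ if $c_k<n$. Then $S$ is an $m$-reduced zigzag stack if and only if, for each such set $J$, with all degrees computed in $S$: (1) $\mathrm{ld}(i)+\mathrm{rd}(i+m-1)\le2$ whenever $i,i+m-1\in J$; and (2) $j-i\ge m-1$ whenever $i<j$, $i,j\in J$, $\mathrm{ld}(i)>0$ and $\mathrm{rd}(j)>0$.
   Context: $[n]=\{1,\dots,n\}$. A diagram on $[n]$ is a simple graph on vertex set $[n]$, vertices drawn in increasing order on a line; an edge $\{i,j\}$ with $i<j$ is an arc $(i,j)$. Arcs $(i_1,j_1),(i_2,j_2)$ cross if $i_1<i_2<j_1<j_2$; a stack is a diagram without crossing arcs. For a vertex $v$, $\mathrm{ld}(v)$ (resp. $\mathrm{rd}(v)$) is the number of arcs $(i,v)$ with $i<v$ (resp. $(v,j)$ with $j>v$). A zigzag stack is a stack in which every vertex has degree at most $2$ and no vertex $v$ has both $\mathrm{ld}(v)>0$ and $\mathrm{rd}(v)>0$. A zigzag stack on $[n]$ is $m$-reduced if (1) $\mathrm{ld}(i)+\mathrm{rd}(i+m-1)\le 2$ for all $1\le i\le n-m+1$, and (2) whenever $1\le i<j\le n$, $\mathrm{ld}(i)>0$, $\mathrm{rd}(j)>0$, we have $j-i\ge m-1$. The primary component of $S$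 is the connected component (as a graph) containing vertex $1$. -}

module Defs where

open import Data.Nat using (ℕ; zero; suc; _+_; _∸_; _≤_; _<_)
open import Data.Bool using (Bool; true; false)
open import Data.Product using (_×_; Σ)
open import Data.Sum using (_⊎_)
open import Relation.Nullary using (¬_)
open import Relation.Binary.PropositionalEquality using (_≡_)

record Diagram (n : ℕ) : Set where
  field
    arc : ℕ → ℕ → Bool
    wf  : ∀ i j → arc i j ≡ true → (1 ≤ i) × (i < j) × (j ≤ n)
open Diagram public

count : (ℕ → Bool) → ℕ → ℕ
count f zero = zero
count f (suc k) with f k
... | true  = suc (count f k)
... | false = count f k

module _ {n : ℕ} (D : Diagram n) where

  -- ld v = #{ i : (i,v) arc }, rd v = #{ j : (v,j) arc }  (all endpoints lie in [n])
  ld : ℕ → ℕ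
  ld v = count (λ i → arc D i v) (suc n)

  rd : ℕ → ℕ
  rd v = count (λ j → arc D v j) (suc n)

  Stack : Set
  Stack = ∀ i₁ j₁ i₂ j₂ → arc D i₁ j₁ ≡ true → arc D i₂ j₂ ≡ true →
          ¬ ((i₁ < i₂) × (i₂ < j₁) × (j₁ < j₂))

  ZigzagStack : Set
  ZigzagStack = Stack
              × (∀ v → 1 ≤ v → v ≤ n → ld v + rd v ≤ 2)
              × (∀ v → 1 ≤ v → v ≤ n → ¬ ((0 < ld v) × (0 < rd v)))

  MReduced : ℕ → Set
  MReduced m =
      (∀ i → 1 ≤ i → i + (m ∸ 1) ≤ n → ld i + rd (i + (m ∸ 1)) ≤ 2)
    × (∀ i j → 1 ≤ i → i < j → j ≤ n → 0 < ld i → 0 < rd j → m ∸ 1 ≤ j ∸ i)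

  MReducedZigzagStack : ℕ → Set
  MReducedZigzagStack m = ZigzagStack × MReduced m

  Adj : ℕ → ℕ → Set
  Adj i j = (arc D i j ≡ true) ⊎ (arc D j i ≡ true)

  data InPrimary : ℕ → Set where
    base : 1 ≤ n → InPrimary 1
    step : ∀ {i j} → InPrimary i → Adj i j → InPrimary j

  -- IsJ a b : the interval {a,…,b} is one of the sets J:
  --   either a = c_t, b = c_{t+1} are consecutive vertices of the primary component,
  --   or a = c_k is the largest vertex of the primary component, a < n and b = n.
  IsJ : ℕ → ℕ → Set
  IsJ a b =
      (InPrimary a × InPrimary b × a < b × (∀ x → a < x → x < b → ¬ InPrimary x))
    ⊎ (InPrimary a × a < n × b ≡ n × (∀ x → a < x → x ≤ n → ¬ InPrimary x))

  JCond : ℕ → ℕ → ℕ → Set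
  JCond m a b =
      (∀ i → a ≤ i → i + (m ∸ 1) ≤ b → ld i + rd (i + (m ∸ 1)) ≤ 2)
    × (∀ i j → a ≤ i → i < j → j ≤ b → 0 < ld i → 0 < rd j → m ∸ 1 ≤ j ∸ i)

module Submission where

open import Defs
open import Data.Nat using (ℕ; zero; suc; _+_; _∸_; _≤_; _<_; _≤′_; ≤′-refl; ≤′-step; s≤s; s≤s⁻¹; z≤n; _≤?_; _<?_)
open import Data.Nat.Properties
open import Data.Nat.Induction using (<-wellFounded)
open import Data.Bool using (true; false)
open import Data.Empty using (⊥-elim)
open import Data.Product using (_×_; _,_; proj₁; proj₂; ∃; ∃₂)
open import Data.Sum using (_⊎_; inj₁; inj₂; [_,_]′)
open import Effect.Monad using (RawMonad)
open import Function.Bundles using (_⇔_; mk⇔)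
open import Induction.WellFounded using (Acc; acc)
open import Relation.Binary.PropositionalEquality using (_≡_; refl; sym; trans; subst)
open import Relation.Nullary using (¬_; Dec; yes; no; contradiction)
open import Relation.Nullary.Decidable using (decidable-stable; ¬¬-excluded-middle)
open import Relation.Nullary.Negation using (¬¬-map; ¬¬-Monad)
open import Relation.Unary using (Decidable)

-- If i < j lie in no common set J, some vertex c ≠ 1 of the primary component lies
-- strictly between them, and c carries an arc, so ld c > 0 or rd c > 0.  Replacing
-- (i, j) by the closer pair (c, j) or (i, c) propagates condition (2) from the sets J
-- to all of [n] by induction on j − i.  For condition (1), at distance exactly m − 1
-- such a c would give a pair closer than m − 1, contradicting (2).
-- Membership in the primary component is not decidable as defined, but every goal
-- is, so the case analysis is carried out inside the double-negation monad.

count-positive : ∀ f b k → f k ≡ true → k < b → 0 < count f b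
count-positive f (suc b) k fk k<1+b with f b in fb
... | true  = s≤s z≤n
... | false with m<1+n⇒m<n∨m≡n k<1+b
...   | inj₁ k<b  = count-positive f b k fk k<b
...   | inj₂ refl with trans (sym fk) fb
...     | ()

summands-positive : ∀ {a b c} → a ≤ c → b ≤ c → c < a + b → 0 < a × 0 < b
summands-positive {zero}  _   b≤c c<b = contradiction b≤c (<⇒≱ c<b)
summands-positive {suc a} {zero} {c} a≤c _ c<a = contradiction a≤c (<⇒≱ (subst (c <_) (+-identityʳ (suc a)) c<a))
summands-positive {suc a} {suc b} _ _ _ = s≤s z≤n , s≤s z≤n

Gap : (ℕ → Set) → ℕ → ℕ → Set
Gap P a b = ∀ x → a < x → x < b → ¬ P x

module _ {P : ℕ → Set} where

  Gap-empty : ∀ a → Gap P a (suc a)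
  Gap-empty a x a<x x<1+a = contradiction (s≤s⁻¹ x<1+a) (<⇒≱ a<x)

  Gap-extend : ∀ {a b} → Gap P a b → ¬ P b → Gap P a (suc b)
  Gap-extend gap ¬Pb x a<x x<1+b with m<1+n⇒m<n∨m≡n x<1+b
  ... | inj₁ x<b  = gap x a<x x<b
  ... | inj₂ refl = ¬Pb

  module _ (P? : Decidable P) where

    lastAtMost : ∀ {s i} → P s → s ≤′ i → ∃ λ a → a ≤ i × P a × Gap P a (suc i)
    lastAtMost {s} Ps ≤′-refl = s , ≤-refl , Ps , Gap-empty s
    lastAtMost {i = suc i} Ps (≤′-step s≤′i) with P? (suc i)
    ... | yes Pi = suc i , ≤-refl , Pi , Gap-empty (suc i)
    ... | no ¬Pi with lastAtMost Ps s≤′i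
    ...   | a , a≤i , Pa , gap = a , m≤n⇒m≤1+n a≤i , Pa , Gap-extend gap ¬Pi

    firstAbove : ∀ {a k} → a ≤′ k → (∃ λ b → a < b × b ≤ k × P b × Gap P a b) ⊎ Gap P a (suc k)
    firstAbove {a} ≤′-refl = inj₂ (Gap-empty a)
    firstAbove {a} {suc k} (≤′-step a≤′k) with firstAbove a≤′k
    ... | inj₁ (b , a<b , b≤k , Pb , gap) = inj₁ (b , a<b , m≤n⇒m≤1+n b≤k , Pb , gap)
    ... | inj₂ gap with P? (suc k)
    ...   | yes Pk = inj₁ (suc k , s≤s (≤′⇒≤ a≤′k) , ≤-refl , Pk , gap)
    ...   | no ¬Pk = inj₂ (Gap-extend gap ¬Pk)

  ¬¬-decidable-bounded : ∀ k → (∀ {x} → P x → x < k) → ¬ ¬ Decidable P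
  ¬¬-decidable-bounded k bounded = ¬¬-map extend (decidable-below k)
    where
    open RawMonad ¬¬-Monad

    decidable-below : ∀ k → ¬ ¬ (∀ x → x < k → Dec (P x))
    decidable-below zero = pure λ _ ()
    decidable-below (suc k) = do
      P<k? ← decidable-below k
      Pk?  ← ¬¬-excluded-middle
      pure λ x x<1+k → [ P<k? x , (λ { refl → Pk? }) ]′ (m<1+n⇒m<n∨m≡n x<1+k)

    extend : (∀ x → x < k → Dec (P x)) → Decidable P
    extend P<k? x with x <? k
    ... | yes x<k = P<k? x x<k
    ... | no  x≮k = no λ Px → x≮k (bounded Px)

module _ {n : ℕ} (S : Diagram n) where

  InPrimary-bounded : ∀ {x} → InPrimary S x → 1 ≤ x × x ≤ n
  InPrimary-bounded (base 1≤n) = ≤-refl , 1≤n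
  InPrimary-bounded (step {i} {j} _ (inj₁ ij)) with wf S i j ij
  ... | 1≤i , i<j , j≤n = ≤-trans 1≤i (<⇒≤ i<j) , j≤n
  InPrimary-bounded (step {i} {j} _ (inj₂ ji)) with wf S j i ji
  ... | 1≤j , j<i , i≤n = 1≤j , ≤-trans (<⇒≤ j<i) i≤n

  InPrimary-incident : ∀ {x} → InPrimary S x → 1 < x → 0 < ld S x ⊎ 0 < rd S x
  InPrimary-incident (base _) (s≤s ())
  InPrimary-incident (step {i} {j} _ (inj₁ ij)) _ with wf S i j ij
  ... | _ , i<j , j≤n = inj₁ (count-positive (λ k → arc S k j) (suc n) i ij (s≤s (≤-trans (<⇒≤ i<j) j≤n)))
  InPrimary-incident (step {i} {j} _ (inj₂ ji)) _ with wf S j i ji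
  ... | _ , _ , i≤n = inj₂ (count-positive (λ k → arc S j k) (suc n) i ji (s≤s i≤n))

  IsJ-bounded : ∀ {a b} → IsJ S a b → 1 ≤ a × b ≤ n
  IsJ-bounded (inj₁ (Pa , Pb , _)) = proj₁ (InPrimary-bounded Pa) , proj₂ (InPrimary-bounded Pb)
  IsJ-bounded (inj₂ (Pa , _ , refl , _)) = proj₁ (InPrimary-bounded Pa) , ≤-refl

  PrimaryBetween : ℕ → ℕ → Set
  PrimaryBetween i j = ∃ λ c → i < c × c < j × InPrimary S c

  InCommonJ : ℕ → ℕ → Set
  InCommonJ i j = ∃₂ λ a b → IsJ S a b × a ≤ i × j ≤ b

  primaryBetween⊎inCommonJ : Decidable (InPrimary S) → ∀ {i j} → 1 ≤ i → i < j → j ≤ n →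
                             PrimaryBetween i j ⊎ InCommonJ i j
  primaryBetween⊎inCommonJ P? {i} {j} 1≤i i<j j≤n
    with lastAtMost P? (base 1≤n) (≤⇒≤′ 1≤i)
    where 1≤n = ≤-trans 1≤i (≤-trans (<⇒≤ i<j) j≤n)
  ... | a , a≤i , Pa , gapᵢ with firstAbove P? (≤⇒≤′ a≤n)
    where a≤n = ≤-trans a≤i (≤-trans (<⇒≤ i<j) j≤n)
  ...   | inj₂ gapₙ = inj₂ (a , n , inj₂ (Pa , a<n , refl , λ x a<x x≤n → gapₙ x a<x (s≤s x≤n)) , a≤i , j≤n)
    where a<n = ≤-<-trans a≤i (<-≤-trans i<j j≤n)
  ...   | inj₁ (b , a<b , _ , Pb , gapᵦ) with i <? b | b <? j
  ...     | no i≮b  | _       = contradiction Pb (gapᵢ b a<b (s≤s (≮⇒≥ i≮b)))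
  ...     | yes i<b | yes b<j = inj₁ (b , i<b , b<j , Pb)
  ...     | yes _   | no b≮j  = inj₂ (a , b , inj₁ (Pa , Pb , a<b , gapᵦ) , a≤i , ≮⇒≥ b≮j)

  ¬¬-primaryBetween⊎inCommonJ : ∀ {i j} → 1 ≤ i → i < j → j ≤ n → ¬ ¬ (PrimaryBetween i j ⊎ InCommonJ i j)
  ¬¬-primaryBetween⊎inCommonJ 1≤i i<j j≤n =
    ¬¬-map (λ P? → primaryBetween⊎inCommonJ P? 1≤i i<j j≤n)
           (¬¬-decidable-bounded (suc n) (λ Px → s≤s (proj₂ (InPrimary-bounded Px))))

  MReduced⇒JCond : ∀ {m a b} → MReduced S m → IsJ S a b → JCond S m a b
  MReduced⇒JCond (reduced₁ , reduced₂) J with IsJ-bounded J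
  ... | 1≤a , b≤n =
    (λ i a≤i i+m-1≤b → reduced₁ i (≤-trans 1≤a a≤i) (≤-trans i+m-1≤b b≤n)) ,
    (λ i j a≤i i<j j≤b → reduced₂ i j (≤-trans 1≤a a≤i) i<j (≤-trans j≤b b≤n))

  module _ (m : ℕ) (jcond : ∀ a b → IsJ S a b → JCond S m a b) where

    distance-bound : ∀ i j → 1 ≤ i → i < j → j ≤ n → 0 < ld S i → 0 < rd S j → m ∸ 1 ≤ j ∸ i
    distance-bound i j = go (<-wellFounded (j ∸ i))
      where
      go : ∀ {i j} → Acc _<_ (j ∸ i) → 1 ≤ i → i < j → j ≤ n → 0 < ld S i → 0 < rd S j → m ∸ 1 ≤ j ∸ i
      go {i} {j} (acc closer) 1≤i i<j j≤n ldᵢ rdⱼ =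
        decidable-stable (m ∸ 1 ≤? j ∸ i) (¬¬-map via (¬¬-primaryBetween⊎inCommonJ 1≤i i<j j≤n))
        where
        via : PrimaryBetween i j ⊎ InCommonJ i j → m ∸ 1 ≤ j ∸ i
        via (inj₂ (a , b , J , a≤i , j≤b)) = proj₂ (jcond a b J) i j a≤i i<j j≤b ldᵢ rdⱼ
        via (inj₁ (c , i<c , c<j , Pc)) with InPrimary-incident Pc (≤-<-trans 1≤i i<c)
        ... | inj₁ ldᶜ = ≤-trans (go (closer (∸-monoʳ-< i<c (<⇒≤ c<j))) (≤-trans 1≤i (<⇒≤ i<c)) c<j j≤n ldᶜ rdⱼ)
                                 (∸-monoʳ-≤ j (<⇒≤ i<c))
        ... | inj₂ rdᶜ = ≤-trans (go (closer (∸-monoˡ-< c<j (<⇒≤ i<c))) 1≤i i<c (≤-trans (<⇒≤ c<j) j≤n) ldᵢ rdᶜ)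
                                 (∸-monoˡ-≤ i (<⇒≤ c<j))

    module _ (degree≤2 : ∀ v → 1 ≤ v → v ≤ n → ld S v + rd S v ≤ 2) where

      degree-bound : ∀ i → 1 ≤ i → i + (m ∸ 1) ≤ n → ld S i + rd S (i + (m ∸ 1)) ≤ 2
      degree-bound i 1≤i j≤n with ld S i + rd S j ≤? 2
        where j = i + (m ∸ 1)
      ... | yes ok = ok
      ... | no ¬ok with m≤n⇒m<n∨m≡n (m≤m+n i (m ∸ 1))
      ...   | inj₂ i≡j = contradiction (subst (λ j → ld S i + rd S j ≤ 2) i≡j (degree≤2 i 1≤i i≤n)) ¬ok
        where i≤n = ≤-trans (m≤m+n i (m ∸ 1)) j≤n
      ...   | inj₁ i<j = ⊥-elim (¬¬-primaryBetween⊎inCommonJ 1≤i i<j j≤n λ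
        { (inj₂ (a , b , J , a≤i , j≤b)) → ¬ok (proj₁ (jcond a b J) i a≤i j≤b)
        ; (inj₁ between) → unseparated between })
        where
        j = i + (m ∸ 1)

        ldᵢ×rdⱼ : 0 < ld S i × 0 < rd S j
        ldᵢ×rdⱼ = summands-positive
          (≤-trans (m≤m+n _ (rd S i)) (degree≤2 i 1≤i (≤-trans (<⇒≤ i<j) j≤n)))
          (≤-trans (m≤n+m _ (ld S j)) (degree≤2 j (≤-trans 1≤i (<⇒≤ i<j)) j≤n))
          (≰⇒> ¬ok)

        j∸i≡m∸1 : j ∸ i ≡ m ∸ 1
        j∸i≡m∸1 = m+n∸m≡n i (m ∸ 1)

        unseparated : ¬ PrimaryBetween i j
        unseparated (c , i<c , c<j , Pc) with InPrimary-incident Pc (≤-<-trans 1≤i i<c)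
        ... | inj₁ ldᶜ = <⇒≱ (subst (j ∸ c <_) j∸i≡m∸1 (∸-monoʳ-< i<c (<⇒≤ c<j)))
                             (distance-bound c j (≤-trans 1≤i (<⇒≤ i<c)) c<j j≤n ldᶜ (proj₂ ldᵢ×rdⱼ))
        ... | inj₂ rdᶜ = <⇒≱ (subst (c ∸ i <_) j∸i≡m∸1 (∸-monoˡ-< c<j (<⇒≤ i<c)))
                             (distance-bound i c 1≤i i<c (≤-trans (<⇒≤ c<j) j≤n) (proj₁ ldᵢ×rdⱼ) rdᶜ)

      JCond⇒MReduced : MReduced S m
      JCond⇒MReduced = degree-bound , distance-bound

mainTheorem7 : (m n : ℕ) → 2 ≤ m → 1 ≤ n → (S : Diagram n) → ZigzagStack S →
    (MReducedZigzagStack S m ⇔ (∀ a b → IsJ S a b → JCond S m a b))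
mainTheorem7 m n _ _ S zigzag@(_ , degree≤2 , _) =
  mk⇔ (λ (_ , reduced) a b → MReduced⇒JCond S {m} reduced)
      (λ jcond → zigzag , JCond⇒MReduced S m jcond degree≤2)
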